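{- Let $G$ be a group and let $f:G\to\{0,1\}$ be founded on a valued tree of cosets $(T,\mathcal H,d,v)$ which is linear, irreducible and infinite. Then $f$ is not periodic.
   Context: A valued tree of cosets of $G$ is $(T,\mathcal H,d,v)$ where $T\subseteq\omega^{<\omega}$ is a finitely branching tree with leaves $T_L$, $H_\eta\le G$ and $d_\eta\in G$ ($\eta\in T$) satisfy: $H_\varnothing=G$; $H_{\eta^\frown i}=H_{\eta^\frown j}$ whenever both nodes are in $T$; $H_{\eta^\frown i}$ is a proper finite-index subgroup of $H_\eta$; for non-leaves $\eta$, $d_\eta H_\eta$ is the disjoint union of the $d_{\eta^\frown i}H_{\eta^\frown i}$, $\eta^\frown i\in T$; every $g\in G$ lies in $d_\eta H_\eta$ for some leaf $\eta$; and $v:T_L\to\{0,1\}$. Let $f_T(g)$ be the unique leaf $\eta$ with $g\in d_\eta H_\eta$; $f$ is founded on the tree if $f=v\circ f_T$. The tree is linear if $H_\eta=A_{|\eta|}$ for a decreasing sequence $G=A_0\ge A_1\ge\dots$ of normal subgroups of finite index. A node $\eta$ is homogeneous if $v$ is constant on the leaves extending $\eta$; the tree is irreducible if every homogeneous node is a leaf. $f$ is periodic if $\mathrm{Per}(f)=\{t\in G:\forall x\in G\ f(xt)=f(x)\}$ has finite index in $G$. -}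

module Defs where

open import Level using (Level; _⊔_; suc)
open import Algebra.Bundles using (Group)
open import Data.Bool using (Bool)
open import Data.Nat using (ℕ; _<_)
open import Data.List using (List; []; _∷ʳ_; _++_; length)
open import Data.List.Relation.Unary.All using (All)
open import Data.List.Relation.Unary.Any using (Any)
open import Data.List.Membership.Propositional using (_∈_)
open import Data.Product using (Σ; ∃; _×_; _,_)
open import Relation.Nullary using (¬_)
open import Relation.Binary.PropositionalEquality using (_≡_)
open import Function.Bundles using (_⇔_)

-- Nodes of ω^{<ω} are lists of naturals; η ⌢ i is  η ∷ʳ i.
Node : Set
Node = List ℕ

module _ {c ℓ} (G : Group c ℓ) where
  open Group G

  Subset : (p : Level) → Set (c ⊔ suc p)
  Subset p = Carrier → Set p

  module _ {p : Level} where

    _⊆_ : Subset p → Subset p → Set (c ⊔ p)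
    A ⊆ B = ∀ g → A g → B g

    _≐_ : Subset p → Subset p → Set (c ⊔ p)
    A ≐ B = ∀ g → (A g ⇔ B g)

    Whole : Subset p → Set (c ⊔ p)
    Whole A = ∀ g → A g

    record IsSubgroup (H : Subset p) : Set (c ⊔ ℓ ⊔ p) where
      field
        resp   : ∀ {x y} → x ≈ y → H x → H y
        has-ε  : H ε
        has-∙  : ∀ {x y} → H x → H y → H (x ∙ y)
        has-⁻¹ : ∀ {x} → H x → H (x ⁻¹)

    InCoset : Carrier → Subset p → Carrier → Set p
    InCoset d H g = H (d ⁻¹ ∙ g)

    FiniteIndexIn : Subset p → Subset p → Set (c ⊔ p)
    FiniteIndexIn K H =
      Σ (List Carrier) λ rs → All H rs × (∀ h → H h → Any (λ r → K (r ⁻¹ ∙ h)) rs)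

    ProperFiniteIndexSubgroup : Subset p → Subset p → Set (c ⊔ ℓ ⊔ p)
    ProperFiniteIndexSubgroup K H =
      IsSubgroup K × K ⊆ H × (∃ λ h → H h × ¬ K h) × FiniteIndexIn K H

    FiniteIndexInG : Subset p → Set (c ⊔ p)
    FiniteIndexInG K = Σ (List Carrier) λ rs → ∀ g → Any (λ r → K (r ⁻¹ ∙ g)) rs

    IsNormal : Subset p → Set (c ⊔ p)
    IsNormal A = ∀ g h → A h → A (g ∙ h ∙ g ⁻¹)

  -- Valued tree of cosets (T, H, d, v).  v is given on all nodes; only its
  -- values on leaves are relevant.
  record ValuedTree (p : Level) : Set (c ⊔ ℓ ⊔ suc p) where
    field
      T : Node → Set p
      H : Node → Subset p
      d : Node → Carrier
      v : Node → Bool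
      root        : T []
      prefixClosed : ∀ η i → T (η ∷ʳ i) → T η
      finBranching : ∀ η → ∃ λ n → ∀ i → T (η ∷ʳ i) → i < n
      H-root      : Whole (H [])
      H-subgroup  : ∀ η → T η → IsSubgroup (H η)
      H-siblings  : ∀ η i j → T (η ∷ʳ i) → T (η ∷ʳ j) → H (η ∷ʳ i) ≐ H (η ∷ʳ j)
      H-child     : ∀ η i → T (η ∷ʳ i) → ProperFiniteIndexSubgroup (H (η ∷ʳ i)) (H η)
      cover-children : ∀ η → T η → ¬ (∀ i → ¬ T (η ∷ʳ i)) → ∀ g →
        (InCoset (d η) (H η) g ⇔ (∃ λ i → T (η ∷ʳ i) × InCoset (d (η ∷ʳ i)) (H (η ∷ʳ i)) g))
      disjoint-children : ∀ η i j → T (η ∷ʳ i) → T (η ∷ʳ j) → ¬ (i ≡ j) → ∀ g →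
        ¬ (InCoset (d (η ∷ʳ i)) (H (η ∷ʳ i)) g × InCoset (d (η ∷ʳ j)) (H (η ∷ʳ j)) g)

    Leaf : Node → Set p
    Leaf η = T η × (∀ i → ¬ T (η ∷ʳ i))

    field
      cover-leaves : ∀ g → ∃ λ η → Leaf η × InCoset (d η) (H η) g

    Extends : Node → Node → Set
    Extends μ η = ∃ λ s → μ ≡ η ++ s

    FoundedOn : (Carrier → Bool) → Set (c ⊔ p)
    FoundedOn f = ∀ g η → Leaf η → InCoset (d η) (H η) g → f g ≡ v η

    Linear : Set (c ⊔ ℓ ⊔ suc p)
    Linear = Σ (ℕ → Subset p) λ A →
      Whole (A 0) ×
      (∀ n → A (ℕ.suc n) ⊆ A n) ×
      (∀ n → IsSubgroup (A n) × IsNormal (A n) × FiniteIndexInG (A n)) ×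
      (∀ η → T η → H η ≐ A (length η))

    Homogeneous : Node → Set p
    Homogeneous η = ∀ μ μ′ → Leaf μ → Leaf μ′ → Extends μ η → Extends μ′ η → v μ ≡ v μ′

    Irreducible : Set p
    Irreducible = ∀ η → T η → Homogeneous η → Leaf η

    Infinite : Set p
    Infinite = ¬ (Σ (List Node) λ l → ∀ η → T η → η ∈ l)

  Per : (Carrier → Bool) → Subset (c)
  Per f t = ∀ x → f (x ∙ t) ≡ f x

  Periodic : (Carrier → Bool) → Set c
  Periodic f = FiniteIndexInG (Per f)

{-# OPTIONS --safe #-}
module Submission where

-- Suppose Per f has finite index, with representatives r₁ … rₘ. For each r the set of depths k at
-- which r·Per f meets A_k is downward closed, so (classically, hence here under double negation)
-- beyond some depth n each rᵢ·Per f meets either every A_k or none of them. Then any a ∈ A_n lies in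
-- some r·Per f that also contains elements a′ of arbitrarily deep A_k, and f(y a) = f(y r) = f(y a′)
-- for all y. Choosing k beyond the leaf containing d_η shows that f is constant on d_η A_|η| whenever
-- |η| ≥ n; such nodes are homogeneous, hence leaves, so the finitely branching tree T has depth at
-- most n and is finite.

open import Defs
open import Algebra.Bundles using (Group)
open import Data.Bool using (Bool)
open import Relation.Nullary using (¬_)

import Algebra.Properties.Group as GroupProperties
open import Level using () renaming (_⊔_ to _⊔ˡ_)
open import Data.Bool.Properties using () renaming (_≟_ to _≟ᵇ_)
open import Data.Empty using (⊥-elim)
open import Data.List using (List; []; _∷_; _∷ʳ_; _++_; [_]; length; map; concatMap; upTo)
open import Data.List.Properties using (++-assoc; ++-identityʳ; length-++)
open import Data.List.Membership.Propositional using (_∈_)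
open import Data.List.Membership.Propositional.Properties using (∈-map⁺; ∈-++⁺ˡ; ∈-++⁺ʳ; ∈-concat⁺′; ∈-upTo⁺)
open import Data.List.Relation.Unary.All as All using (All; []; _∷_; lookupAny)
open import Data.List.Relation.Unary.Any using (Any; here)
open import Data.List.Reverse using (Reverse; []; _∶_∶ʳ_; reverseView)
open import Data.Nat using (ℕ; zero; suc; _≤_; _⊔_; _≤?_; z≤n; s≤s)
open import Data.Nat.Properties using (≤-trans; m≤m⊔n; m≤n⊔m; m≤n⇒m<n∨m≡n; ≰⇒>; +-comm)
open import Data.Product using (∃; _×_; _,_; proj₁; proj₂)
open import Data.Sum using (inj₁; inj₂)
open import Function.Bundles using (Equivalence)
open import Relation.Nullary.Decidable using (yes; no; decidable-stable; ¬¬-excluded-middle)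
open import Relation.Binary.PropositionalEquality as ≡ using (_≡_; refl; subst)

length-∷ʳ : ∀ {a} {A : Set a} (xs : List A) x → length (xs ∷ʳ x) ≡ suc (length xs)
length-∷ʳ xs x = ≡.trans (length-++ xs) (+-comm (length xs) 1)

module _ {a q} {X : Set a} (P : X → ℕ → Set q)
         (antitone : ∀ x {j k} → j ≤ k → P x k → P x j) where

  StableFrom : ℕ → X → Set q
  StableFrom n x = P x n → ∀ k → n ≤ k → ¬ ¬ P x k

  stableFrom-mono : ∀ {m n} → m ≤ n → ∀ x → StableFrom m x → StableFrom n x
  stableFrom-mono m≤n x stable Pn k n≤k = stable (antitone x m≤n Pn) k (≤-trans m≤n n≤k)

  ¬¬-stableFrom : ∀ xs → ¬ ¬ ∃ λ n → All (StableFrom n) xs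
  ¬¬-stableFrom [] ¬goal = ¬goal (0 , [])
  ¬¬-stableFrom (x ∷ xs) ¬goal = ¬¬-stableFrom xs λ (n , stable) →
    ¬¬-excluded-middle {A = ∃ λ j → ¬ P x j} λ
      { (yes (j , ¬Pj)) → ¬goal (n ⊔ j ,
          (λ Pn⊔j → ⊥-elim (¬Pj (antitone x (m≤n⊔m n j) Pn⊔j)))
          ∷ All.map (stableFrom-mono (m≤m⊔n n j) _) stable)
      ; (no ∄) → ¬goal (n , (λ _ k _ ¬Pk → ∄ (k , ¬Pk)) ∷ stable)
      }

module _ {c ℓ} (G : Group c ℓ) where
  open Group G hiding (refl)
  open GroupProperties G using (\\-leftDividesˡ)
  open Equivalence using (to; from)

  x∙y∙y⁻¹∙z≈x∙z : ∀ x y z → (x ∙ y) ∙ (y ⁻¹ ∙ z) ≈ x ∙ z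
  x∙y∙y⁻¹∙z≈x∙z x y z = trans (assoc x y (y ⁻¹ ∙ z)) (∙-congˡ (\\-leftDividesˡ y z))

  module _ {p} {K : Subset G p} (K-subgroup : IsSubgroup G K) where
    open IsSubgroup K-subgroup

    InCoset-self : ∀ d → InCoset G d K d
    InCoset-self d = resp (sym (inverseˡ d)) has-ε

    InCoset-∙ʳ : ∀ {d g a} → InCoset G d K g → K a → InCoset G d K (g ∙ a)
    InCoset-∙ʳ {d} {g} {a} g∈dK a∈K = resp (assoc (d ⁻¹) g a) (has-∙ g∈dK a∈K)

  module _ {f : Carrier → Bool} (f-cong : ∀ {x y} → x ≈ y → f x ≡ f y) where

    Per-coset-value : ∀ {r a} → Per G f (r ⁻¹ ∙ a) → ∀ y → f (y ∙ a) ≡ f (y ∙ r)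
    Per-coset-value {r} {a} per y = ≡.trans (≡.sym (f-cong (x∙y∙y⁻¹∙z≈x∙z y r a))) (per (y ∙ r))

  module DescendingChain {p} (A : ℕ → Subset G p) (A-step : ∀ n → _⊆_ G (A (suc n)) (A n)) where

    A-antitone : ∀ {j k} → j ≤ k → _⊆_ G (A k) (A j)
    A-antitone {k = zero} z≤n a a∈A₀ = a∈A₀
    A-antitone {k = suc k} j≤k+1 a a∈Aₖ₊₁ with m≤n⇒m<n∨m≡n j≤k+1
    ... | inj₁ (s≤s j≤k) = A-antitone j≤k a (A-step k a a∈Aₖ₊₁)
    ... | inj₂ refl = a∈Aₖ₊₁

    module _ {f : Carrier → Bool} (f-cong : ∀ {x y} → x ≈ y → f x ≡ f y) where

      MeetsCoset : Carrier → ℕ → Set (c ⊔ˡ p)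
      MeetsCoset r k = ∃ λ a → A k a × Per G f (r ⁻¹ ∙ a)

      meetsCoset-antitone : ∀ r {j k} → j ≤ k → MeetsCoset r k → MeetsCoset r j
      meetsCoset-antitone r j≤k (a , a∈Aₖ , a∈rPer) = a , A-antitone j≤k a a∈Aₖ , a∈rPer

      ¬¬-deep-representative : ∀ {rs} → (∀ g → Any (λ r → Per G f (r ⁻¹ ∙ g)) rs) →
        ∀ {n} → All (StableFrom MeetsCoset meetsCoset-antitone n) rs →
        ∀ {a} → A n a → ∀ k → n ≤ k → ¬ ¬ ∃ λ a′ → A k a′ × ∀ y → f (y ∙ a) ≡ f (y ∙ a′)
      ¬¬-deep-representative cover stable {a} a∈Aₙ k n≤k ¬goal with lookupAny stable (cover a)
      ... | stableᵣ , a∈rPer = stableᵣ (a , a∈Aₙ , a∈rPer) k n≤k λ (a′ , a′∈Aₖ , a′∈rPer) →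
        ¬goal (a′ , a′∈Aₖ , λ y → ≡.trans (Per-coset-value f-cong a∈rPer y)
                                          (≡.sym (Per-coset-value f-cong a′∈rPer y)))

  module ValuedTreeProperties {p} (VT : ValuedTree G p) where
    open ValuedTree VT

    Coset : Node → Subset G p
    Coset η = InCoset G (d η) (H η)

    child-coset-⊆ : ∀ {η i} → T (η ∷ʳ i) → _⊆_ G (Coset (η ∷ʳ i)) (Coset η)
    child-coset-⊆ {η} {i} t g g∈ =
      from (cover-children η (prefixClosed η i t) (λ childless → childless i t) g) (i , t , g∈)

    descendant-coset-⊆ : ∀ η {s} → Reverse s → T (η ++ s) → _⊆_ G (Coset (η ++ s)) (Coset η)
    descendant-coset-⊆ η [] _ rewrite ++-identityʳ η = λ _ g∈ → g∈
    descendant-coset-⊆ η (s ∶ r ∶ʳ i) t rewrite ≡.sym (++-assoc η s [ i ]) =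
      λ g g∈ → descendant-coset-⊆ η r (prefixClosed (η ++ s) i t) g (child-coset-⊆ t g g∈)

    depth-≤ : ∀ n → (∀ η → T η → n ≤ length η → Leaf η) → ∀ η → T η → length η ≤ n
    depth-≤ n deep η = go (reverseView η)
      where
      go : ∀ {η} → Reverse η → T η → length η ≤ n
      go [] _ = z≤n
      go (ζ ∶ _ ∶ʳ i) t with n ≤? length ζ
      ... | yes n≤|ζ| = ⊥-elim (proj₂ (deep ζ (prefixClosed ζ i t) n≤|ζ|) i t)
      ... | no  n≰|ζ| = subst (_≤ n) (≡.sym (length-∷ʳ ζ i)) (≰⇒> n≰|ζ|)

    children : Node → List Node
    children ζ = map (ζ ∷ʳ_) (upTo (proj₁ (finBranching ζ)))

    nodesUpTo : ℕ → List Node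
    nodesUpTo zero    = [ [] ]
    nodesUpTo (suc D) = nodesUpTo D ++ concatMap children (nodesUpTo D)

    []∈nodesUpTo : ∀ D → [] ∈ nodesUpTo D
    []∈nodesUpTo zero    = here refl
    []∈nodesUpTo (suc D) = ∈-++⁺ˡ ([]∈nodesUpTo D)

    ∈-nodesUpTo : ∀ {η} → Reverse η → T η → ∀ {D} → length η ≤ D → η ∈ nodesUpTo D
    ∈-nodesUpTo [] _ {D} _ = []∈nodesUpTo D
    ∈-nodesUpTo (ζ ∶ r ∶ʳ i) t {D} |ζi|≤D with subst (_≤ D) (length-∷ʳ ζ i) |ζi|≤D
    ... | s≤s |ζ|≤D′ = ∈-++⁺ʳ _ (∈-concat⁺′ (∈-map⁺ (ζ ∷ʳ_) (∈-upTo⁺ (proj₂ (finBranching ζ) i t)))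
                                            (∈-map⁺ children (∈-nodesUpTo r (prefixClosed ζ i t) |ζ|≤D′)))

    bounded-depth⇒¬Infinite : ∀ n → (∀ η → T η → length η ≤ n) → ¬ Infinite
    bounded-depth⇒¬Infinite n bounded infinite =
      infinite (nodesUpTo n , λ η t → ∈-nodesUpTo (reverseView η) t (bounded η t))

    module _ {f : Carrier → Bool} (founded : FoundedOn f) where

      f-cong : ∀ {x y} → x ≈ y → f x ≡ f y
      f-cong {x} {y} x≈y with cover-leaves x
      ... | μ , leaf , x∈μ = ≡.trans (founded x μ leaf x∈μ)
        (≡.sym (founded y μ leaf (IsSubgroup.resp (H-subgroup μ (proj₁ leaf)) (∙-congˡ x≈y) x∈μ)))

      leaf-coset-invariant : ∀ {μ g a} → Leaf μ → Coset μ g → H μ a → f (g ∙ a) ≡ f g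
      leaf-coset-invariant {μ} {g} {a} leaf g∈μ a∈Hμ = ≡.trans
        (founded (g ∙ a) μ leaf (InCoset-∙ʳ (H-subgroup μ (proj₁ leaf)) g∈μ a∈Hμ))
        (≡.sym (founded g μ leaf g∈μ))

      constant-on-coset⇒homogeneous : ∀ {η} → (∀ g → Coset η g → f g ≡ f (d η)) → Homogeneous η
      constant-on-coset⇒homogeneous {η} constant μ μ′ leaf leaf′ μ⊒η μ′⊒η =
        ≡.trans (leaf-value μ leaf μ⊒η) (≡.sym (leaf-value μ′ leaf′ μ′⊒η))
        where
        leaf-value : ∀ ν → Leaf ν → Extends ν η → v ν ≡ f (d η)
        leaf-value ν leaf (s , refl) = ≡.trans (≡.sym (founded (d ν) ν leaf dν∈ν))
          (constant (d ν) (descendant-coset-⊆ η (reverseView s) (proj₁ leaf) (d ν) dν∈ν))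
          where
          dν∈ν : Coset ν (d ν)
          dν∈ν = InCoset-self (H-subgroup ν (proj₁ leaf)) (d ν)

      module _ (A : ℕ → Subset G p) (A-step : ∀ n → _⊆_ G (A (suc n)) (A n))
               (H≐A : ∀ η → T η → _≐_ G (H η) (A (length η))) where
        open DescendingChain A A-step

        constant-on-deep-coset : ∀ {rs} → (∀ g → Any (λ r → Per G f (r ⁻¹ ∙ g)) rs) →
          ∀ {n} → All (StableFrom (MeetsCoset f-cong) (meetsCoset-antitone f-cong) n) rs →
          ∀ η → T η → n ≤ length η → ∀ g → Coset η g → f g ≡ f (d η)
        constant-on-deep-coset cover {n} stable η tη n≤|η| g g∈η with cover-leaves (d η)
        ... | μ , leaf , dη∈μ = decidable-stable (f g ≟ᵇ f (d η)) λ fg≢fdη →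
          ¬¬-deep-representative f-cong cover stable a∈Aₙ k (≤-trans n≤|η| (m≤m⊔n _ _))
            λ (a′ , a′∈Aₖ , same) → fg≢fdη (begin
              f g           ≡⟨ f-cong (sym (\\-leftDividesˡ (d η) g)) ⟩
              f (d η ∙ a)   ≡⟨ same (d η) ⟩
              f (d η ∙ a′)  ≡⟨ leaf-coset-invariant leaf dη∈μ
                                 (from (H≐A μ (proj₁ leaf) a′) (A-antitone (m≤n⊔m _ _) a′ a′∈Aₖ)) ⟩
              f (d η)       ∎)
          where
          open ≡.≡-Reasoning
          a : Carrier
          a = d η ⁻¹ ∙ g
          k : ℕ
          k = length η ⊔ length μ
          a∈Aₙ : A n a
          a∈Aₙ = A-antitone n≤|η| a (to (H≐A η tη a) g∈η)

proposition3p21 : ∀ {c ℓ p} (G : Group c ℓ) (VT : ValuedTree G p) (f : Group.Carrier G → Bool) →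
    ValuedTree.FoundedOn VT f → ValuedTree.Linear VT → ValuedTree.Irreducible VT →
    ValuedTree.Infinite VT → ¬ Periodic G f
proposition3p21 G VT f founded (A , _ , A-step , _ , H≐A) irreducible infinite (rs , cover) =
  ¬¬-stableFrom (MeetsCoset (f-cong founded)) (meetsCoset-antitone (f-cong founded)) rs λ (n , stable) →
    bounded-depth⇒¬Infinite n (depth-≤ n λ η tη n≤|η| →
      irreducible η tη (constant-on-coset⇒homogeneous founded
        (constant-on-deep-coset founded A A-step H≐A cover stable η tη n≤|η|)))
      infinite
  where
  open ValuedTreeProperties G VT
  open DescendingChain G A A-step
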